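{- Let $\tilde\alpha,\tilde\alpha'\in\{0,1\}^n$ both have more than $n/2$ components equal to $1$, let $\tilde\alpha\le\tilde\alpha'$ componentwise, and let $\alpha_i$ be a $1$-component that is unbound in $\tilde\alpha$. Then $\alpha'_i$ is a $1$-component that is unbound in $\tilde\alpha'$.
   Context: Indices are cyclic modulo $n$. For $i,j\in\{1,\dots,n\}$ the segment $\tilde\alpha[i:j]$ is $(\alpha_i,\dots,\alpha_j)$ if $i\le j$ and $(\alpha_i,\dots,\alpha_n,\alpha_1,\dots,\alpha_j)$ if $i>j$. Its prefixes are the segments $\tilde\alpha[i:j']$ with $j'$ strictly before $j$ in the cyclic traversal from $i$. A segment is balanced / $0$-dominated if its number of zeros is equal to / greater than its number of ones. A minimal balanced segment is a balanced segment every prefix of which is $0$-dominated. A component $\alpha_i=0$ and a component $\alpha_j=1$ are connected if $\tilde\alpha[i:j]$ is a minimal balanced segment. A component is bound if it is connected to some component, unbound otherwise. A $1$-component is a component equal to $1$. -}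

module Defs where

open import Data.Bool using (Bool; true; false)
open import Data.Nat using (ℕ; zero; suc; _+_; _*_; _∸_; _≤_; _<_; _<?_; _≤?_)
open import Data.Fin using (Fin; toℕ; fromℕ<)
open import Data.List using (List; []; _∷_; allFin; map)
import Data.Bool
open import Data.Product using (Σ; _×_)
open import Data.Sum using (_⊎_)
open import Relation.Nullary using (yes; no)
open import Relation.Nullary.Negation using (¬_)
open import Relation.Binary.PropositionalEquality using (_≡_)

-- A binary word of length n, indexed 0..n-1 (the paper's 1..n, shifted).
Word : ℕ → Set
Word n = Fin n → Bool

ones : List Bool → ℕ
ones []           = 0
ones (true ∷ xs)  = suc (ones xs)
ones (false ∷ xs) = ones xs

zeros : List Bool → ℕ
zeros []           = 0
zeros (true ∷ xs)  = zeros xs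
zeros (false ∷ xs) = suc (zeros xs)

onesW : ∀ {n} → Word n → ℕ
onesW {n} α = ones (map α (allFin n))

next : ∀ {n} → Fin n → Fin n
next {suc m} i with suc (toℕ i) <? suc m
... | yes p = fromℕ< p
... | no _  = Fin.zero

-- the list (α_i, α_{i+1}, ..., α_{i+k}) read cyclically (k+1 entries)
walk : ∀ {n} → Word n → Fin n → ℕ → List Bool
walk α i zero    = α i ∷ []
walk α i (suc k) = α i ∷ walk α (next i) k

dist : ∀ {n} → Fin n → Fin n → ℕ
dist {n} i j with toℕ i ≤? toℕ j
... | yes _ = toℕ j ∸ toℕ i
... | no _  = (n ∸ toℕ i) + toℕ j

segment : ∀ {n} → Word n → Fin n → Fin n → List Bool
segment α i j = walk α i (dist i j)

Balanced : List Bool → Set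
Balanced xs = zeros xs ≡ ones xs

ZeroDominated : List Bool → Set
ZeroDominated xs = ones xs < zeros xs

-- α[i:j] is minimal balanced: balanced, and every prefix α[i:j'] (j' strictly
-- before j in the cyclic traversal from i) is 0-dominated
MinimalBalanced : ∀ {n} → Word n → Fin n → Fin n → Set
MinimalBalanced α i j =
  Balanced (segment α i j) × (∀ k → k < dist i j → ZeroDominated (walk α i k))

Connected : ∀ {n} → Word n → Fin n → Fin n → Set
Connected α i j = α i ≡ false × α j ≡ true × MinimalBalanced α i j

Bound : ∀ {n} → Word n → Fin n → Set
Bound α i = Σ _ λ j → Connected α i j ⊎ Connected α j i

Unbound : ∀ {n} → Word n → Fin n → Set
Unbound α i = ¬ Bound α i

_≤W_ : ∀ {n} → Word n → Word n → Set
α ≤W β = ∀ i → Data.Bool._≤_ (α i) (β i)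

module Submission where

-- Read a word backwards from a 1-component α_i that is
-- unbound.  Call a list of bits *heavy* if each of its nonempty suffixes has
-- more ones than zeros.  Walking from i back to any position p, the segment
-- α[p:i] stays heavy: prepending a 1 keeps it heavy, and prepending a 0 to a
-- heavy list either keeps it heavy or produces a minimal balanced list, which
-- would connect α_p to α_i — impossible since α_i is unbound.  So every
-- segment α[j:i] has more ones than zeros.  Raising bits only adds ones and
-- removes zeros, hence α′[j:i] is never balanced and nothing connects to α′_i
-- from the left; from the right nothing can, since α′_i = 1.

open import Defs
open import Data.Nat using (ℕ; zero; suc; _+_; _*_; _∸_; _≤_; _<_; z≤n; s≤s; s≤s⁻¹; _≤?_; _<?_; pred)
open import Data.Nat.Properties
open import Data.Fin using (Fin; toℕ)
open import Data.Fin.Properties using (toℕ-fromℕ<; toℕ-injective; toℕ<n)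
open import Data.Bool using (Bool; true; false)
import Data.Bool as B
open import Data.List using (List; []; _∷_; _++_; take; drop; length)
open import Data.List.Properties using (take++drop≡id)
open import Data.Product using (Σ; _×_; _,_; proj₁; proj₂)
open import Data.Sum using (_⊎_; inj₁; inj₂)
open import Data.Empty using (⊥-elim)
open import Function using (_∘_)
open import Relation.Nullary using (yes; no; ¬_)
open import Relation.Binary.PropositionalEquality
  using (_≡_; refl; sym; trans; cong; subst; module ≡-Reasoning)

ones-++ : ∀ xs ys → ones (xs ++ ys) ≡ ones xs + ones ys
ones-++ []           ys = refl
ones-++ (true ∷ xs)  ys = cong suc (ones-++ xs ys)
ones-++ (false ∷ xs) ys = ones-++ xs ys

zeros-++ : ∀ xs ys → zeros (xs ++ ys) ≡ zeros xs + zeros ys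
zeros-++ []           ys = refl
zeros-++ (true ∷ xs)  ys = zeros-++ xs ys
zeros-++ (false ∷ xs) ys = cong suc (zeros-++ xs ys)

OneDominated : List Bool → Set
OneDominated xs = zeros xs < ones xs

-- A list is heavy if every nonempty suffix is 1-dominated.  The inductive
-- form builds the list from the back, starting from a single 1.
data Heavy : List Bool → Set where
  single : Heavy (true ∷ [])
  _◂_    : ∀ {x xs} → Heavy xs → OneDominated (x ∷ xs) → Heavy (x ∷ xs)

heavy⇒oneDominated : ∀ {xs} → Heavy xs → OneDominated xs
heavy⇒oneDominated single  = s≤s z≤n
heavy⇒oneDominated (_ ◂ d) = d

heavy-suffix : ∀ {xs} k → Heavy xs → k < length xs → OneDominated (drop k xs)
heavy-suffix zero    h       _         = heavy⇒oneDominated h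
heavy-suffix (suc k) single  (s≤s ())
heavy-suffix (suc k) (h ◂ _) (s≤s k<n) = heavy-suffix k h k<n

MinimalBalancedList : List Bool → Set
MinimalBalancedList xs =
  Balanced xs × (∀ k → suc k < length xs → ZeroDominated (take (suc k) xs))

-- If a 0 followed by a heavy list is balanced, every proper prefix of it is
-- 0-dominated: the complementary suffix of the heavy tail has surplus ones.
balanced-prefix : ∀ {xs} → Heavy xs → suc (zeros xs) ≡ ones xs →
  ∀ k → suc k < length (false ∷ xs) → ZeroDominated (take (suc k) (false ∷ xs))
balanced-prefix {xs} h bal k (s≤s k<n) =
  s≤s (+-cancelʳ-≤ (ones d) (ones t) (zeros t) count)
  where
  t d : List Bool
  t = take k xs
  d = drop k xs
  count : ones t + ones d ≤ zeros t + ones d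
  count = begin
    ones t + ones d         ≡⟨ sym (ones-++ t d) ⟩
    ones (t ++ d)           ≡⟨ cong ones (take++drop≡id k xs) ⟩
    ones xs                 ≡⟨ sym bal ⟩
    suc (zeros xs)          ≡⟨ cong (suc ∘ zeros) (sym (take++drop≡id k xs)) ⟩
    suc (zeros (t ++ d))    ≡⟨ cong suc (zeros-++ t d) ⟩
    suc (zeros t + zeros d) ≡⟨ sym (+-suc (zeros t) (zeros d)) ⟩
    zeros t + suc (zeros d) ≤⟨ +-monoʳ-≤ (zeros t) (heavy-suffix k h k<n) ⟩
    zeros t + ones d        ∎
    where open ≤-Reasoning

heavy-cons : ∀ {xs} → Heavy xs → (x : Bool) →
  Heavy (x ∷ xs) ⊎ (x ≡ false × MinimalBalancedList (x ∷ xs))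
heavy-cons h true = inj₁ (h ◂ m<n⇒m<1+n (heavy⇒oneDominated h))
heavy-cons h false with m≤n⇒m<n∨m≡n (heavy⇒oneDominated h)
... | inj₁ surplus = inj₁ (h ◂ surplus)
... | inj₂ bal     = inj₂ (refl , bal , balanced-prefix h bal)

toℕ-next : ∀ {m} (p : Fin (suc m)) →
  (toℕ p < m × toℕ (next p) ≡ suc (toℕ p)) ⊎ (toℕ p ≡ m × toℕ (next p) ≡ 0)
toℕ-next {m} p with suc (toℕ p) <? suc m
... | yes lt = inj₁ (s≤s⁻¹ lt , toℕ-fromℕ< lt)
... | no ¬lt = inj₂ (≤-antisym (s≤s⁻¹ (toℕ<n p)) (s≤s⁻¹ (≮⇒≥ ¬lt)) , refl)

dist-≤ : ∀ {n} (p i : Fin n) → toℕ p ≤ toℕ i → dist p i ≡ toℕ i ∸ toℕ p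
dist-≤ p i p≤i with toℕ p ≤? toℕ i
... | yes _ = refl
... | no p≰i = ⊥-elim (p≰i p≤i)

dist-≰ : ∀ {n} (p i : Fin n) → ¬ toℕ p ≤ toℕ i → dist {n} p i ≡ (n ∸ toℕ p) + toℕ i
dist-≰ p i p≰i with toℕ p ≤? toℕ i
... | yes p≤i = ⊥-elim (p≰i p≤i)
... | no _ = refl

dist-zero : ∀ {n} (p i : Fin n) → dist p i ≡ 0 → p ≡ i
dist-zero {n} p i e with toℕ p ≤? toℕ i
... | yes p≤i = toℕ-injective (≤-antisym p≤i (m∸n≡0⇒m≤n e))
... | no _ = ⊥-elim (<⇒≱ (toℕ<n p) (m∸n≡0⇒m≤n (m+n≡0⇒m≡0 (n ∸ toℕ p) e)))

-- One step forward shortens a positive distance to i by one.  (Matching on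
-- the comparison of p and i also unfolds 'dist p i' in the hypothesis.)
dist-next : ∀ {n} (p i : Fin n) {d} → dist p i ≡ suc d → dist (next p) i ≡ d
dist-next {suc m} p i {d} e with toℕ-next p | toℕ p ≤? toℕ i
... | inj₁ (p<m , p′) | yes p≤i = begin
  dist (next p) i         ≡⟨ dist-≤ (next p) i (subst (_≤ toℕ i) (sym p′) p<i) ⟩
  toℕ i ∸ toℕ (next p)    ≡⟨ cong (toℕ i ∸_) p′ ⟩
  toℕ i ∸ suc (toℕ p)     ≡⟨ sym (pred[m∸n]≡m∸[1+n] (toℕ i) (toℕ p)) ⟩
  pred (toℕ i ∸ toℕ p)    ≡⟨ cong pred e ⟩
  d                       ∎
  where
  open ≡-Reasoning
  p<i : toℕ p < toℕ i
  p<i = m∸n≢0⇒n<m (λ i∸p≡0 → 0≢1+n (trans (sym i∸p≡0) e))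
... | inj₁ (p<m , p′) | no p≰i = suc-injective (begin
  suc (dist (next p) i)                ≡⟨ cong suc (dist-≰ (next p) i p′≰i) ⟩
  suc ((suc m ∸ toℕ (next p)) + toℕ i) ≡⟨ cong (λ x → suc ((suc m ∸ x) + toℕ i)) p′ ⟩
  suc ((m ∸ toℕ p) + toℕ i)            ≡⟨ cong (_+ toℕ i) (sym (+-∸-assoc 1 (<⇒≤ p<m))) ⟩
  (suc m ∸ toℕ p) + toℕ i              ≡⟨ e ⟩
  suc d                                ∎)
  where
  open ≡-Reasoning
  p′≰i : ¬ toℕ (next p) ≤ toℕ i
  p′≰i p′≤i = p≰i (≤-trans (n≤1+n (toℕ p)) (subst (_≤ toℕ i) p′ p′≤i))
... | inj₂ (p≡m , _) | yes p≤i = ⊥-elim (0≢1+n (begin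
  0                   ≡⟨ sym (m≤n⇒m∸n≡0 i≤p) ⟩
  toℕ i ∸ toℕ p       ≡⟨ e ⟩
  suc d               ∎))
  where
  open ≡-Reasoning
  i≤p : toℕ i ≤ toℕ p
  i≤p = subst (toℕ i ≤_) (sym p≡m) (s≤s⁻¹ (toℕ<n i))
... | inj₂ (p≡m , p′) | no p≰i = suc-injective (begin
  suc (dist (next p) i)      ≡⟨ cong suc (dist-≤ (next p) i (subst (_≤ toℕ i) (sym p′) z≤n)) ⟩
  suc (toℕ i ∸ toℕ (next p)) ≡⟨ cong (suc ∘ (toℕ i ∸_)) p′ ⟩
  suc (toℕ i)                ≡⟨ cong (_+ toℕ i) (sym (trans (cong (suc m ∸_) p≡m) (m+n∸n≡m 1 m))) ⟩
  (suc m ∸ toℕ p) + toℕ i    ≡⟨ e ⟩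
  suc d                      ∎)
  where open ≡-Reasoning

length-walk : ∀ {n} (α : Word n) p d → length (walk α p d) ≡ suc d
length-walk α p zero    = refl
length-walk α p (suc d) = cong suc (length-walk α (next p) d)

walk-prefix : ∀ {n} (α : Word n) p {k d} → k ≤ d → take (suc k) (walk α p d) ≡ walk α p k
walk-prefix α p {zero}  {zero}  _         = refl
walk-prefix α p {zero}  {suc d} _         = refl
walk-prefix α p {suc k} (s≤s k≤d)         = cong (α p ∷_) (walk-prefix α (next p) k≤d)

minimalBalanced-walk : ∀ {n} (α : Word n) p i {d} → dist p i ≡ d →
  MinimalBalancedList (walk α p d) → MinimalBalanced α p i
minimalBalanced-walk α p i refl (bal , prefixes) = bal , λ k k<d →
  subst ZeroDominated (walk-prefix α p (<⇒≤ k<d))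
    (prefixes k (subst (suc k <_) (sym (length-walk α p _)) (s≤s k<d)))

cons-mono : ∀ {x y xs ys} → x B.≤ y → ones xs ≤ ones ys → zeros ys ≤ zeros xs →
  ones (x ∷ xs) ≤ ones (y ∷ ys) × zeros (y ∷ ys) ≤ zeros (x ∷ xs)
cons-mono             B.f≤t o z = m≤n⇒m≤1+n o , m≤n⇒m≤1+n z
cons-mono {x = true}  B.b≤b o z = s≤s o , z
cons-mono {x = false} B.b≤b o z = o , s≤s z

raise-true : ∀ {x y} → x B.≤ y → x ≡ true → y ≡ true
raise-true B.b≤b x≡true = x≡true
raise-true B.f≤t _      = refl

walk-mono : ∀ {n} {α α′ : Word n} → α ≤W α′ → ∀ p d →
  ones (walk α p d) ≤ ones (walk α′ p d) × zeros (walk α′ p d) ≤ zeros (walk α p d)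
walk-mono α≤α′ p zero    = cons-mono (α≤α′ p) z≤n z≤n
walk-mono α≤α′ p (suc d) with walk-mono α≤α′ (next p) d
... | o , z = cons-mono (α≤α′ p) o z

heavy-or-connected : ∀ {n} (α : Word n) i → α i ≡ true → ∀ d p → dist p i ≡ d →
  Heavy (walk α p d) ⊎ Σ (Fin n) (λ m → Connected α m i)
heavy-or-connected α i αi zero p e with dist-zero p i e
... | refl = inj₁ (subst (λ x → Heavy (x ∷ [])) (sym αi) single)
heavy-or-connected α i αi (suc d) p e
  with heavy-or-connected α i αi d (next p) (dist-next p i e)
... | inj₂ connected = inj₂ connected
... | inj₁ heavy with heavy-cons heavy (α p)
...   | inj₁ heavier         = inj₁ heavier
...   | inj₂ (αp , minimal) = inj₂ (p , αp , αi , minimalBalanced-walk α p i e minimal)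

unbound⇒oneDominated : ∀ {n} (α : Word n) i → α i ≡ true → Unbound α i →
  ∀ p → OneDominated (segment α p i)
unbound⇒oneDominated α i αi unbound p
  with heavy-or-connected α i αi (dist p i) p refl
... | inj₁ heavy       = heavy⇒oneDominated heavy
... | inj₂ (m , conn) = ⊥-elim (unbound (m , inj₂ conn))

corollary2 : (n : ℕ) (α α′ : Word n) →
    n < 2 * onesW α → n < 2 * onesW α′ → α ≤W α′ →
    (i : Fin n) → α i ≡ true → Unbound α i →
    α′ i ≡ true × Unbound α′ i
corollary2 n α α′ _ _ α≤α′ i αi unbound = α′i , unbound′
  where
  α′i : α′ i ≡ true
  α′i = raise-true (α≤α′ i) αi

  -- α′_i = 1 cannot be the 0 of a connected pair, and a 0 at j connected to
  -- α′_i would make α′[j:i] balanced although α[j:i] is 1-dominated.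
  unbound′ : Unbound α′ i
  unbound′ (j , inj₁ (α′i≡false , _)) with trans (sym α′i≡false) α′i
  ... | ()
  unbound′ (j , inj₂ (_ , _ , balanced′ , _)) =
    <⇒≱ (unbound⇒oneDominated α i αi unbound j) (begin
      ones (segment α j i)   ≤⟨ proj₁ (walk-mono α≤α′ j (dist j i)) ⟩
      ones (segment α′ j i)  ≡⟨ sym balanced′ ⟩
      zeros (segment α′ j i) ≤⟨ proj₂ (walk-mono α≤α′ j (dist j i)) ⟩
      zeros (segment α j i)  ∎)
    where open ≤-Reasoning
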